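{- Every prime $p$ with $7<p<160$ is good.
   Context: Let $\Phi_3(x)=x^2+x+1$. Let $\Sigma$ be the set of primes $p$ with $p\equiv 2$ or $p \equiv 4 \pmod 7$. For a prime $x$, let $T(x)$ be the set of primes $q\neq 3$ with $q \mid \Phi_3(x)$. For a prime $p>7$ define recursively $S_0(p)=\{p\}$ and $S_{m+1}(p)=S_m(p)\cup\bigcup_{x\in S_m(p)} T(x)$. A prime $p>7$ is called good if there is an integer $m\ge 0$ with $S_m(p)\cap\Sigma\neq\emptyset$. -}

module Defs where

open import Data.Nat using (ℕ; zero; suc; _+_; _*_; _%_)
open import Data.Nat.Divisibility using (_∣_)
open import Data.Nat.Primality using (Prime)
open import Data.Product using (_×_; ∃-syntax)
open import Data.Sum using (_⊎_)
open import Relation.Binary.PropositionalEquality using (_≡_; _≢_)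

Φ₃ : ℕ → ℕ
Φ₃ x = x * x + x + 1

InΣ : ℕ → Set
InΣ p = Prime p × (p % 7 ≡ 2 ⊎ p % 7 ≡ 4)

InT : ℕ → ℕ → Set
InT x q = Prime q × q ≢ 3 × q ∣ Φ₃ x

InS : ℕ → ℕ → ℕ → Set
InS zero    p q = q ≡ p
InS (suc m) p q = InS m p q ⊎ (∃[ x ] (InS m p x × InT x q))

Good : ℕ → Set
Good p = ∃[ m ] ∃[ q ] (InS m p q × InΣ q)

-- A prime x links to every q ∈ T(x), and S_m(q) ⊆ S_{m+1}(x), so goodness
-- propagates backwards along links.  Every prime 7 < p < 160 is therefore
-- good because of an explicit chain of links ending in Σ; the primes on the
-- chains are certified by trial division up to their square roots; the
-- largest, 3737657091169, lies on the only chain starting at 13, 61 or 97.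
module Submission where

open import Defs
open import Data.Bool.Base using (Bool; true; false; T; not; _∧_; _∨_)
open import Data.List.Base using (List; []; _∷_)
open import Data.List.Relation.Unary.All using (All; []; _∷_; lookup)
open import Data.Nat.Base using (ℕ; zero; suc; 2+; _<_; _<ᵇ_; _*_; _%_; NonTrivial)
open import Data.Nat.Divisibility using (_∣?_)
open import Data.Nat.Primality using (Prime; prime?; _Rough_; 2-rough; ∤⇒rough-suc; rough∧square>⇒prime)
open import Data.Nat.Properties using (_≟_; _<?_; <ᵇ-reflects-<; allUpTo?)
open import Data.List.Membership.DecPropositional _≟_ using (_∈_; _∈?_)
open import Data.Product.Base using (_,_)
open import Data.Sum.Base using (inj₁; inj₂)
open import Relation.Binary.PropositionalEquality.Core using (refl)
open import Relation.Nullary.Reflects using (ofʸ; ofⁿ)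
open import Relation.Nullary.Decidable using (does; no; True; toWitness; from-yes; ¬?; _×-dec_; _⊎-dec_; _→-dec_)

trialDivision : (fuel d n : ℕ) → Bool
trialDivision zero       d n = false
trialDivision (suc fuel) d n = (n <ᵇ d * d) ∨ (not (does (d ∣? n)) ∧ trialDivision fuel (suc d) n)

trialDivision-sound : ∀ fuel {d n} .{{_ : NonTrivial n}} →
                      d Rough n → T (trialDivision fuel d n) → Prime n
trialDivision-sound (suc fuel) {d} {n} rough ok with n <ᵇ d * d | <ᵇ-reflects-< n (d * d) | d ∣? n
... | true  | ofʸ n<d*d | _      = rough∧square>⇒prime rough n<d*d
... | false | ofⁿ _     | no d∤n = trialDivision-sound fuel (∤⇒rough-suc d∤n rough) ok

primeᵇ : ℕ → Bool
primeᵇ n = (1 <ᵇ n) ∧ trialDivision n 2 n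

primeᵇ-sound : ∀ n → T (primeᵇ n) → Prime n
primeᵇ-sound n@(2+ _) ok = trialDivision-sound n 2-rough ok

InT∧InS⇒InS-suc : ∀ {x q r} m → InT x q → InS m q r → InS (suc m) x r
InT∧InS⇒InS-suc zero    x→q refl               = inj₂ (_ , refl , x→q)
InT∧InS⇒InS-suc (suc m) x→q (inj₁ r∈S)         = inj₁ (InT∧InS⇒InS-suc m x→q r∈S)
InT∧InS⇒InS-suc (suc m) x→q (inj₂ (y , y∈S , y→r)) = inj₂ (y , InT∧InS⇒InS-suc m x→q y∈S , y→r)

InT∧Good⇒Good : ∀ {x q} → InT x q → Good q → Good x
InT∧Good⇒Good x→q (m , r , r∈S , r∈Σ) = suc m , r , InT∧InS⇒InS-suc m x→q r∈S , r∈Σ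

InΣ⇒Good : ∀ {p} → InΣ p → Good p
InΣ⇒Good {p} p∈Σ = 0 , p , refl , p∈Σ

good-by-link : ∀ x q {q-prime : T (primeᵇ q)} {x→q : True (¬? (q ≟ 3) ×-dec q ∣? Φ₃ x)} →
               Good q → Good x
good-by-link x q {q-prime} {x→q} =
  InT∧Good⇒Good (primeᵇ-sound q q-prime , toWitness x→q)

good-in-Σ : ∀ p {p-prime : T (primeᵇ p)} {p∈Σ : True (p % 7 ≟ 2 ⊎-dec p % 7 ≟ 4)} → Good p
good-in-Σ p {p-prime} {p∈Σ} = InΣ⇒Good (primeᵇ-sound p p-prime , toWitness p∈Σ)

primes-between-7-and-160 : List ℕ
primes-between-7-and-160 =
  11 ∷ 13 ∷ 17 ∷ 19 ∷ 23 ∷ 29 ∷ 31 ∷ 37 ∷ 41 ∷ 43 ∷ 47 ∷ 53 ∷ 59 ∷ 61 ∷ 67 ∷ 71 ∷ 73 ∷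
  79 ∷ 83 ∷ 89 ∷ 97 ∷ 101 ∷ 103 ∷ 107 ∷ 109 ∷ 113 ∷ 127 ∷ 131 ∷ 137 ∷ 139 ∷ 149 ∷ 151 ∷ 157 ∷ []

∈-primes-between-7-and-160 : ∀ {p} → p < 160 → Prime p → 7 < p → p ∈ primes-between-7-and-160
∈-primes-between-7-and-160 =
  from-yes (allUpTo? (λ p → prime? p →-dec (7 <? p →-dec p ∈? primes-between-7-and-160)) 160)

good-primes-between-7-and-160 : All Good primes-between-7-and-160
good-primes-between-7-and-160 =
  good-in-Σ 11 ∷
  good-13 ∷
  good-by-link 17 307 (good-by-link 307 43 good-43) ∷
  good-19 ∷
  good-in-Σ 23 ∷
  good-by-link 29 67 good-67 ∷
  good-31 ∷
  good-37 ∷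
  good-by-link 41 1723 (good-by-link 1723 990151 (good-by-link 990151 147739 (good-in-Σ 147739))) ∷
  good-43 ∷
  good-by-link 47 37 good-37 ∷
  good-in-Σ 53 ∷
  good-by-link 59 3541 (good-by-link 3541 37 good-37) ∷
  good-61 ∷
  good-67 ∷
  good-by-link 71 5113 (good-by-link 5113 8715961 (good-in-Σ 8715961)) ∷
  good-by-link 73 1801 (good-in-Σ 1801) ∷
  good-in-Σ 79 ∷
  good-by-link 83 19 good-19 ∷
  good-by-link 89 8011 (good-by-link 8011 1645747 (good-by-link 1645747 2503 (good-in-Σ 2503))) ∷
  good-97 ∷
  good-by-link 101 10303 (good-by-link 10303 6073 (good-in-Σ 6073)) ∷
  good-by-link 103 3571 (good-by-link 3571 139 good-139) ∷
  good-in-Σ 107 ∷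
  good-in-Σ 109 ∷
  good-by-link 113 991 (good-in-Σ 991) ∷
  good-127 ∷
  good-by-link 131 17293 (good-by-link 17293 7668337
    (good-by-link 7668337 24460537 (good-by-link 24460537 331 (good-in-Σ 331)))) ∷
  good-in-Σ 137 ∷
  good-139 ∷
  good-in-Σ 149 ∷
  good-in-Σ 151 ∷
  good-by-link 157 8269 (good-in-Σ 8269) ∷
  []
  where
  good-37 : Good 37
  good-37 = good-in-Σ 37

  good-43 : Good 43
  good-43 = good-by-link 43 631 (good-by-link 631 433 (good-by-link 433 37 good-37))

  good-31 : Good 31
  good-31 = good-by-link 31 331 (good-in-Σ 331)

  good-127 : Good 127
  good-127 = good-by-link 127 5419 (good-by-link 5419 31 good-31)

  good-19 : Good 19
  good-19 = good-by-link 19 127 good-127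

  good-67 : Good 67
  good-67 = good-in-Σ 67

  good-139 : Good 139
  good-139 = good-by-link 139 499 (good-in-Σ 499)

  good-97 : Good 97
  good-97 =
    good-by-link 97 3169 (good-by-link 3169 3348577 (good-by-link 3348577 3737657091169
      (good-by-link 3737657091169 987900542491 (good-in-Σ 987900542491))))

  good-61 : Good 61
  good-61 = good-by-link 61 97 good-97

  good-13 : Good 13
  good-13 = good-by-link 13 61 good-61

proposition1p5 : (p : ℕ) → Prime p → 7 < p → p < 160 → Good p
proposition1p5 p p-prime 7<p p<160 =
  lookup good-primes-between-7-and-160 (∈-primes-between-7-and-160 p<160 p-prime 7<p)
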